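{- Let $BS(1,3)=\langle a,b\mid ab=ba^3\rangle$. Let $S\subseteq BS(1,3)$ be a finite set of size $k$, and suppose $S=S_0\cup S_1\cup\cdots\cup S_t$ (decomposition described in the context) with $t\geq 2$. Writing $S^2=\{st:s,t\in S\}$: (a) If $k_0=|S_0|\geq 2$ and $k_i=|S_i|=1$ for $1\leq i\leq t$, then $|S^2|\geq \frac{7}{2}k-6$. (b) If $k_t=|S_t|\geq 2$ and $k_i=|S_i|=1$ for $1\leq i\leq t-1$, then $|S^2|\geq \frac{7}{2}k-6$.
   Context: In $BS(1,3)$ one has $(b^m a^x)(b^n a^y)=b^{m+n}a^{3^n x+y}$ for integers $m,n\ge 0$ and $x,y$. The notation $S=S_0\cup S_1\cup\cdots\cup S_t$ means: $0\le m_0<m_1<\cdots<m_t$ are integers, $S_i=b^{m_i}a^{A_i}=\{b^{m_i}a^x: x\in A_i\}$ with $A_i\subseteq\mathbb{Z}$ finite nonempty, and $S$ is the disjoint union of the $S_i$ (so $S_i=S\cap b^{m_i}a^{\mathbb{Z}}$); $k_i=|S_i|$. -}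

module Defs where

open import Data.Nat using (ℕ; _+_; _^_)
open import Data.Integer using (ℤ; +_) renaming (_+_ to _+ℤ_; _*_ to _*ℤ_)
import Data.Integer as ℤ
import Data.Nat as ℕ
open import Data.Product using (_×_; _,_)
open import Data.Product.Properties using (≡-dec)
open import Data.Fin using (Fin)
open import Relation.Nullary using (Dec)
open import Relation.Binary.PropositionalEquality using (_≡_)
open import Data.List using (List; map; concatMap; length; deduplicate; allFin)

-- The element b^m a^x of BS(1,3) (m ≥ 0, x ∈ ℤ) is represented by the pair (m , x).
-- By the normal form in BS(1,3) this representation is injective.
Elt : Set
Elt = ℕ × ℤ

-- (b^m a^x)(b^n a^y) = b^(m+n) a^(3^n x + y)
_·_ : Elt → Elt → Elt
(m , x) · (n , y) = (m + n , (+ (3 ^ n)) *ℤ x +ℤ y)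

_≟E_ : (u v : Elt) → Dec (u ≡ v)
_≟E_ = ≡-dec ℕ._≟_ ℤ._≟_

-- S = S_0 ∪ ... ∪ S_t with S_i = b^(m i) a^(A i), as a list of elements.
SList : (t : ℕ) → (Fin (ℕ.suc t) → ℕ) → (Fin (ℕ.suc t) → List ℤ) → List Elt
SList t m A = concatMap (λ i → map (λ x → (m i , x)) (A i)) (allFin (ℕ.suc t))

sq : List Elt → List Elt
sq S = concatMap (λ s → map (λ u → s · u) S) S

card : List Elt → ℕ
card L = length (deduplicate _≟E_ L)

{-# OPTIONS --safe #-}
-- Call ℓ the level of b^ℓ a^x.  S_i S_j lies on level m_i + m_j, where it is the dilated sumset
-- 3^(m_j)·A_i + A_j; this has at least |A_i| + |A_j| − 1 elements, since 3^(m_j)·min A_i + A_j and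
-- 3^(m_j)·(A_i ∖ min A_i) + max A_j are disjoint.  If moreover A_i = {a} and m_i ≥ 1, the level has at
-- least |A_j| + 1 elements: the dilate 3^(m_i)·A_j + a, which lies in S_j S_i, is too wide to fit inside
-- the translate 3^(m_j) a + A_j = S_i S_j.  The 2t + 1 levels
--   m_0 + m_0 < m_0 + m_1 < ⋯ < m_0 + m_t < m_1 + m_t < ⋯ < m_t + m_t
-- are distinct, so these bounds add up to a lower bound for |S²|; in each of the cases (a) and (b)
-- a polynomial inequality in t and the k_i then gives 2|S²| + 12 ≥ 7k.
module Submission where

open import Defs
open import Data.Nat as ℕ using (ℕ; suc; zero; _+_; _*_; _^_; _≤_; _<_; z≤n; s≤s)
import Data.Nat.Properties as ℕ
open import Data.Nat.Tactic.RingSolver as ℕ-Solver using ()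
open import Data.Nat.ListAction using (sum)
open import Data.Nat.ListAction.Properties using (sum-++)
open import Data.Integer as ℤ using (ℤ; +_; 1ℤ)
import Data.Integer.Properties as ℤ
open import Data.Integer.Tactic.RingSolver as ℤ-Solver using ()
open import Algebra.Properties.AbelianGroup ℤ.+-0-abelianGroup using (∙-cancelˡ; ∙-cancelʳ)
open import Algebra.Properties.CommutativeMonoid.Sum ℕ.+-0-commutativeMonoid
  using (sum-syntax; sum-cong-≗; sum-init-last; ∑-distrib-+)
open import Data.Fin using (Fin; zero; suc; fromℕ; inject₁) renaming (_<_ to _<F_)
import Data.Fin.Properties as Fin
open import Data.List using (List; []; _∷_; [_]; _++_; length; map; filter; concat; tabulate; allFin; deduplicate)
import Data.List.Properties as List
open import Data.List.Extrema ℤ.≤-totalOrder using (min; max; argmin-sel; argmax-sel; min≤⊤; min≤xs; ⊥≤max; xs≤max)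
open import Data.List.Membership.Propositional using (_∈_; _─_)
open import Data.List.Membership.Propositional.Properties
open import Data.List.Membership.DecPropositional ℤ._≟_ using (_∈?_)
open import Data.List.Relation.Binary.Subset.Propositional using (_⊆_)
open import Data.List.Relation.Binary.Disjoint.Propositional using (Disjoint)
open import Data.List.Relation.Unary.All as All using (All; []; _∷_)
import Data.List.Relation.Unary.All.Properties as All
open import Data.List.Relation.Unary.AllPairs as AllPairs using (AllPairs; []; _∷_)
import Data.List.Relation.Unary.AllPairs.Properties as AllPairs
open import Data.List.Relation.Unary.Any using (here; there)
open import Data.List.Relation.Unary.Unique.Propositional using (Unique)
import Data.List.Relation.Unary.Unique.Propositional.Properties as Unique
open import Data.List.Relation.Unary.Unique.DecPropositional.Properties _≟E_ using (deduplicate-!)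
open import Data.Product using (_×_; _,_; proj₁; proj₂; ∃; ∃₂)
open import Data.Sum using (_⊎_; inj₁; inj₂; [_,_]′)
open import Data.Empty using (⊥-elim)
open import Function using (_∘_)
open import Relation.Nullary using (¬_; ¬?; yes; no)
open import Relation.Binary.PropositionalEquality hiding ([_])

∈-─⁺ : ∀ {A : Set} {x y : A} {ys : List A} (p : y ∈ ys) → x ∈ ys → x ≢ y → x ∈ ys ─ p
∈-─⁺ (here refl) (here refl) x≢y   = ⊥-elim (x≢y refl)
∈-─⁺ (here refl) (there x∈ys) _    = x∈ys
∈-─⁺ (there p)   (here refl) _     = here refl
∈-─⁺ (there p)   (there x∈ys) x≢y  = there (∈-─⁺ p x∈ys x≢y)

Unique-⊆⇒length≤ : ∀ {A : Set} {xs ys : List A} → Unique xs → xs ⊆ ys → length xs ≤ length ys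
Unique-⊆⇒length≤ {xs = []} _ _ = z≤n
Unique-⊆⇒length≤ {xs = x ∷ xs} {ys} (x∉xs ∷ !xs) xs⊆ys = begin
  suc (length xs)           ≤⟨ s≤s (Unique-⊆⇒length≤ !xs xs⊆ys─x) ⟩
  suc (length (ys ─ x∈ys))  ≡⟨ List.length-removeAt′ ys _ ⟨
  length ys                 ∎
  where
  open ℕ.≤-Reasoning
  x∈ys = xs⊆ys (here refl)
  xs⊆ys─x : xs ⊆ ys ─ x∈ys
  xs⊆ys─x z∈xs = ∈-─⁺ x∈ys (xs⊆ys (there z∈xs)) λ { refl → All.lookup x∉xs z∈xs refl }

Unique-⊆⇒length≤card : ∀ {xs ys} → Unique xs → xs ⊆ ys → length xs ≤ card ys
Unique-⊆⇒length≤card !xs xs⊆ys = Unique-⊆⇒length≤ !xs (∈-deduplicate⁺ _≟E_ ∘ xs⊆ys)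

length-concat : ∀ {A : Set} (xss : List (List A)) → length (concat xss) ≡ sum (map length xss)
length-concat []         = refl
length-concat (xs ∷ xss) = trans (List.length-++ xs) (cong (_+_ (length xs)) (length-concat xss))

sum-card-disjoint≤card : ∀ {Ts T} → AllPairs Disjoint Ts → All (_⊆ T) Ts → sum (map card Ts) ≤ card T
sum-card-disjoint≤card {Ts} {T} disjoint Ts⊆T = begin
  sum (map card Ts)   ≡⟨ cong sum (List.map-∘ Ts) ⟩
  sum (map length Ds) ≡⟨ length-concat Ds ⟨
  length (concat Ds)  ≤⟨ Unique-⊆⇒length≤card !U U⊆T ⟩
  card T              ∎
  where
  open ℕ.≤-Reasoning
  Ds = map (deduplicate _≟E_) Ts
  !U : Unique (concat Ds)
  !U = Unique.concat⁺ (All.map⁺ (All.universal deduplicate-! Ts)) (AllPairs.map⁺ (AllPairs.map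
         (λ dj {v} (p , q) → dj (∈-deduplicate⁻ _≟E_ _ p , ∈-deduplicate⁻ _≟E_ _ q)) disjoint))
  U⊆T : concat Ds ⊆ T
  U⊆T v∈U with _ , v∈D , D∈Ds ← ∈-concat⁻′ Ds v∈U with T′ , T′∈Ts , refl ← ∈-map⁻ (deduplicate _≟E_) D∈Ds
    = All.lookup Ts⊆T T′∈Ts (∈-deduplicate⁻ _≟E_ T′ v∈D)

atLevel : ℕ → List Elt → List Elt
atLevel ℓ = filter (λ e → proj₁ e ℕ.≟ ℓ)

∈-atLevel⁻ : ∀ ℓ T {e} → e ∈ atLevel ℓ T → e ∈ T × proj₁ e ≡ ℓ
∈-atLevel⁻ ℓ T = ∈-filter⁻ (λ e → proj₁ e ℕ.≟ ℓ) {xs = T}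

sum-card-atLevel≤card : ∀ T {ℓs} → Unique ℓs → sum (map (λ ℓ → card (atLevel ℓ T)) ℓs) ≤ card T
sum-card-atLevel≤card T {ℓs} !ℓs = subst (_≤ card T) (cong sum (sym (List.map-∘ ℓs)))
  (sum-card-disjoint≤card (AllPairs.map⁺ (AllPairs.map levels-disjoint !ℓs))
    (All.map⁺ (All.universal {P = λ ℓ → atLevel ℓ T ⊆ T} (λ ℓ → proj₁ ∘ ∈-atLevel⁻ ℓ T) ℓs)))
  where
  levels-disjoint : ∀ {ℓ ℓ′} → ℓ ≢ ℓ′ → Disjoint (atLevel ℓ T) (atLevel ℓ′ T)
  levels-disjoint {ℓ} {ℓ′} ℓ≢ℓ′ (p , q) =
    ℓ≢ℓ′ (trans (sym (proj₂ (∈-atLevel⁻ ℓ T p))) (proj₂ (∈-atLevel⁻ ℓ′ T q)))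

length≤card-atLevel : ∀ ℓ T {W : List ℤ} → Unique W → (∀ {w} → w ∈ W → (ℓ , w) ∈ T) →
                      length W ≤ card (atLevel ℓ T)
length≤card-atLevel ℓ T {W} !W W⊆T = subst (_≤ card (atLevel ℓ T)) (List.length-map (ℓ ,_) W)
  (Unique-⊆⇒length≤card (Unique.map⁺ (cong proj₂) !W) ℓW⊆T)
  where
  ℓW⊆T : map (ℓ ,_) W ⊆ atLevel ℓ T
  ℓW⊆T v∈ with w , w∈W , refl ← ∈-map⁻ (ℓ ,_) v∈ = ∈-filter⁺ (λ e → proj₁ e ℕ.≟ ℓ) (W⊆T w∈W) refl

∃-minimum : ∀ {xs : List ℤ} → 1 ≤ length xs → ∃ λ a → a ∈ xs × All (a ℤ.≤_) xs
∃-minimum {x ∷ xs} _ = min x xs , min∈ , min≤⊤ x xs ∷ min≤xs x xs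
  where
  min∈ : min x xs ∈ x ∷ xs
  min∈ with argmin-sel (λ y → y) x xs
  ... | inj₁ min≡x  = here min≡x
  ... | inj₂ min∈xs = there min∈xs

∃-maximum : ∀ {xs : List ℤ} → 1 ≤ length xs → ∃ λ b → b ∈ xs × All (ℤ._≤ b) xs
∃-maximum {x ∷ xs} _ = max x xs , max∈ , ⊥≤max x xs ∷ xs≤max x xs
  where
  max∈ : max x xs ∈ x ∷ xs
  max∈ with argmax-sel (λ y → y) x xs
  ... | inj₁ max≡x  = here max≡x
  ... | inj₂ max∈xs = there max∈xs

≤-bounds-distinct⇒< : ∀ {a b y z : ℤ} → a ℤ.≤ y → a ℤ.≤ z → y ℤ.≤ b → z ℤ.≤ b → y ≢ z → a ℤ.< b
≤-bounds-distinct⇒< a≤y a≤z y≤b z≤b y≢z = ℤ.≤∧≢⇒< (ℤ.≤-trans a≤y y≤b)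
  λ { refl → y≢z (ℤ.≤-antisym (ℤ.≤-trans y≤b a≤z) (ℤ.≤-trans z≤b a≤y)) }

dilation-stretches : ∀ {K} → 1 < K → ∀ {x y} → x ℤ.< y → + K ℤ.* x ℤ.+ y ℤ.< + K ℤ.* y ℤ.+ x
dilation-stretches {suc (suc k)} (s≤s (s≤s z≤n)) {x} {y} x<y = begin-strict
  + suc (suc k) ℤ.* x ℤ.+ y      ≡⟨ peel (+ suc k) x y ⟩
  + suc k ℤ.* x ℤ.+ (x ℤ.+ y)    <⟨ ℤ.+-monoˡ-< (x ℤ.+ y) (ℤ.*-monoˡ-<-pos (+ suc k) x<y) ⟩
  + suc k ℤ.* y ℤ.+ (x ℤ.+ y)    ≡⟨ peel′ (+ suc k) x y ⟩
  + suc (suc k) ℤ.* y ℤ.+ x      ∎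
  where
  open ℤ.≤-Reasoning
  peel : ∀ k x y → (1ℤ ℤ.+ k) ℤ.* x ℤ.+ y ≡ k ℤ.* x ℤ.+ (x ℤ.+ y)
  peel = ℤ-Solver.solve-∀
  peel′ : ∀ k x y → k ℤ.* y ℤ.+ (x ℤ.+ y) ≡ (1ℤ ℤ.+ k) ℤ.* y ℤ.+ x
  peel′ = ℤ-Solver.solve-∀

equal-differences : ∀ p q c {d y₀ y₁ : ℤ} → p ℤ.+ d ≡ c ℤ.+ y₀ → q ℤ.+ d ≡ c ℤ.+ y₁ → q ℤ.+ y₀ ≡ p ℤ.+ y₁
equal-differences p q c {d} {y₀} {y₁} e₀ e₁ = ∙-cancelʳ (d ℤ.+ c) _ _ (begin
  (q ℤ.+ y₀) ℤ.+ (d ℤ.+ c)  ≡⟨ regroup q y₀ d c ⟩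
  (q ℤ.+ d) ℤ.+ (c ℤ.+ y₀)  ≡⟨ cong₂ ℤ._+_ e₁ (sym e₀) ⟩
  (c ℤ.+ y₁) ℤ.+ (p ℤ.+ d)  ≡⟨ regroup′ c y₁ p d ⟩
  (p ℤ.+ y₁) ℤ.+ (d ℤ.+ c)  ∎)
  where
  open ≡-Reasoning
  regroup : ∀ q y₀ d c → (q ℤ.+ y₀) ℤ.+ (d ℤ.+ c) ≡ (q ℤ.+ d) ℤ.+ (c ℤ.+ y₀)
  regroup = ℤ-Solver.solve-∀
  regroup′ : ∀ c y₁ p d → (c ℤ.+ y₁) ℤ.+ (p ℤ.+ d) ≡ (p ℤ.+ y₁) ℤ.+ (d ℤ.+ c)
  regroup′ = ℤ-Solver.solve-∀

-- Translates of B have the width b₁ − b₀ of B, while K·B + d has width K (b₁ − b₀).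
dilate-escapes-translate : ∀ {K b₀ b₁} c {d B} → 1 < K → b₀ ℤ.< b₁ → All (b₀ ℤ.≤_) B → All (ℤ._≤ b₁) B →
  ¬ (+ K ℤ.* b₀ ℤ.+ d ∈ map (ℤ._+_ c) B × + K ℤ.* b₁ ℤ.+ d ∈ map (ℤ._+_ c) B)
dilate-escapes-translate {K} {b₀} {b₁} c 1<K b₀<b₁ b₀≤B B≤b₁ (p , q)
  with y₀ , y₀∈B , e₀ ← ∈-map⁻ _ p | y₁ , y₁∈B , e₁ ← ∈-map⁻ _ q = ℤ.<-irrefl refl (begin-strict
    + K ℤ.* b₀ ℤ.+ b₁  <⟨ dilation-stretches 1<K b₀<b₁ ⟩
    + K ℤ.* b₁ ℤ.+ b₀  ≤⟨ ℤ.+-monoʳ-≤ (+ K ℤ.* b₁) (All.lookup b₀≤B y₀∈B) ⟩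
    + K ℤ.* b₁ ℤ.+ y₀  ≡⟨ equal-differences (+ K ℤ.* b₀) (+ K ℤ.* b₁) c e₀ e₁ ⟩
    + K ℤ.* b₀ ℤ.+ y₁  ≤⟨ ℤ.+-monoʳ-≤ (+ K ℤ.* b₀) (All.lookup B≤b₁ y₁∈B) ⟩
    + K ℤ.* b₀ ℤ.+ b₁  ∎)
  where open ℤ.≤-Reasoning

extend-by-one-of : ∀ {P : ℤ → Set} {W u v} → Unique W → All P W → P u → P v → ¬ (u ∈ W × v ∈ W) →
                   ∃ λ W′ → Unique W′ × All P W′ × suc (length W) ≤ length W′
extend-by-one-of {W = W} {u} {v} !W PW Pu Pv ¬both with u ∈? W
... | no u∉W  = u ∷ W , All.¬Any⇒All¬ W u∉W ∷ !W , Pu ∷ PW , ℕ.≤-refl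
... | yes u∈W = v ∷ W , All.¬Any⇒All¬ W (λ v∈W → ¬both (u∈W , v∈W)) ∷ !W , Pv ∷ PW , ℕ.≤-refl

InDilatedSum : ℕ → List ℤ → List ℤ → ℤ → Set
InDilatedSum K A B w = ∃₂ λ x y → x ∈ A × y ∈ B × w ≡ + K ℤ.* x ℤ.+ y

dilatedSum-witness : ∀ K {A B} → 0 < K → Unique A → Unique B → 1 ≤ length A → 1 ≤ length B →
  ∃ λ W → Unique W × All (InDilatedSum K A B) W × length A + length B ≤ suc (length W)
dilatedSum-witness (suc k) {A} {B} _ !A !B 1≤|A| 1≤|B|
  with a , a∈A , a≤A ← ∃-minimum 1≤|A| | b , b∈B , B≤b ← ∃-maximum 1≤|B| =
  W , !W , All.++⁺ (All.map⁺ (All.tabulate λ y∈B → a , _ , a∈A , y∈B , refl))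
                   (All.map⁺ (All.tabulate λ x∈A′ → _ , b , proj₁ (∈-filter⁻ ≢a? x∈A′) , b∈B , refl))
    , |A|+|B|≤1+|W|
  where
  K = + suc k
  ≢a? = λ x → ¬? (x ℤ.≟ a)
  A′ = filter ≢a? A
  W₁ = map (λ y → K ℤ.* a ℤ.+ y) B
  W₂ = map (λ x → K ℤ.* x ℤ.+ b) A′
  W = W₁ ++ W₂
  disjoint : ∀ {w} → ¬ (w ∈ W₁ × w ∈ W₂)
  disjoint (p , q) with y , y∈B , refl ← ∈-map⁻ _ p | x , x∈A′ , eq ← ∈-map⁻ _ q
                   with x∈A , x≢a ← ∈-filter⁻ ≢a? x∈A′ =
    ℤ.<⇒≢ (ℤ.+-mono-<-≤ (ℤ.*-monoˡ-<-pos K a<x) (All.lookup B≤b y∈B)) eq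
    where a<x = ℤ.≤∧≢⇒< (All.lookup a≤A x∈A) (x≢a ∘ sym)
  !W : Unique W
  !W = Unique.++⁺ (Unique.map⁺ (∙-cancelˡ (K ℤ.* a) _ _) !B)
         (Unique.map⁺ (ℤ.*-cancelˡ-≡ K _ _ ∘ ∙-cancelʳ _ _ _) (Unique.filter⁺ ≢a? !A)) disjoint
  A⊆a∷A′ : A ⊆ a ∷ A′
  A⊆a∷A′ {x} x∈A with x ℤ.≟ a
  ... | yes x≡a = here x≡a
  ... | no x≢a  = there (∈-filter⁺ ≢a? x∈A x≢a)
  |A|+|B|≤1+|W| : length A + length B ≤ suc (length W)
  |A|+|B|≤1+|W| = begin
    length A + length B                   ≤⟨ ℕ.+-monoˡ-≤ (length B) (Unique-⊆⇒length≤ !A A⊆a∷A′) ⟩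
    suc (length A′ + length B)            ≡⟨ cong suc (ℕ.+-comm (length A′) (length B)) ⟩
    suc (length B + length A′)            ≡⟨ cong suc (cong₂ _+_ (List.length-map _ B) (List.length-map _ A′)) ⟨
    suc (length W₁ + length W₂)           ≡⟨ cong suc (List.length-++ W₁) ⟨
    suc (length W)                        ∎
    where open ℕ.≤-Reasoning

translate-dilate-witness : ∀ K {K′ A B} → 1 < K′ → length A ≡ 1 → Unique B → 2 ≤ length B →
  ∃ λ W → Unique W × All (λ w → InDilatedSum K A B w ⊎ InDilatedSum K′ B A w) W × suc (length B) ≤ length W
translate-dilate-witness K {B = _ ∷ []} _ _ _ (s≤s ())
translate-dilate-witness K {K′} {a ∷ []} {B@(y ∷ z ∷ _)} 1<K′ refl !B@((y≢z ∷ _) ∷ _) _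
  with b₀ , b₀∈B , b₀≤B ← ∃-minimum {B} (s≤s z≤n) | b₁ , b₁∈B , B≤b₁ ← ∃-maximum {B} (s≤s z≤n) =
  let W , !W , PW , |W₀|<|W| = extend-by-one-of !W₀ PW₀
        (inj₂ (b₀ , a , b₀∈B , here refl , refl)) (inj₂ (b₁ , a , b₁∈B , here refl , refl))
        (dilate-escapes-translate c 1<K′ b₀<b₁ b₀≤B B≤b₁)
  in W , !W , PW , subst (λ n → suc n ≤ length W) (List.length-map _ B) |W₀|<|W|
  where
  c = + K ℤ.* a
  W₀ = map (ℤ._+_ c) B
  !W₀ : Unique W₀
  !W₀ = Unique.map⁺ (∙-cancelˡ c _ _) !B
  PW₀ : All (λ w → InDilatedSum K [ a ] B w ⊎ InDilatedSum K′ B [ a ] w) W₀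
  PW₀ = All.map⁺ (All.tabulate λ y∈B → inj₁ (a , _ , here refl , y∈B , refl))
  b₀<b₁ : b₀ ℤ.< b₁
  b₀<b₁ = ≤-bounds-distinct⇒< (All.lookup b₀≤B (here refl)) (All.lookup b₀≤B (there (here refl)))
                              (All.lookup B≤b₁ (here refl)) (All.lookup B≤b₁ (there (here refl))) y≢z

sum-map-tabulate : ∀ {A : Set} {n} (f : A → ℕ) (g : Fin n → A) → sum (map f (tabulate g)) ≡ ∑[ i < n ] f (g i)
sum-map-tabulate {n = zero}  f g = refl
sum-map-tabulate {n = suc n} f g = cong (_+_ (f (g zero))) (sum-map-tabulate f (λ i → g (suc i)))

∑-mono-≤ : ∀ {n} {f g : Fin n → ℕ} → (∀ i → f i ≤ g i) → ∑[ i < n ] f i ≤ ∑[ i < n ] g i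
∑-mono-≤ {zero}  f≤g = z≤n
∑-mono-≤ {suc n} f≤g = ℕ.+-mono-≤ (f≤g zero) (∑-mono-≤ (λ i → f≤g (suc i)))

∑-const : ∀ n c → ∑[ i < n ] c ≡ n * c
∑-const zero    c = refl
∑-const (suc n) c = cong (_+_ c) (∑-const n c)

∑-ones : ∀ n → ∑[ i < n ] 1 ≡ n
∑-ones n = trans (∑-const n 1) (ℕ.*-identityʳ n)

∑-≥-const : ∀ {n c} {f : Fin n → ℕ} → (∀ i → c ≤ f i) → n * c ≤ ∑[ i < n ] f i
∑-≥-const {n} {c} c≤f = subst (_≤ _) (∑-const n c) (∑-mono-≤ c≤f)

part-a-arithmetic : ∀ {n t F₀ R P} → 2 ≤ n → 2 ≤ t → n + n ≤ suc F₀ → t * suc n ≤ R → t ≤ P →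
                    7 * (n + t) ≤ 2 * (F₀ + R + P) + 12
part-a-arithmetic {n@(suc (suc b))} {t@(suc (suc q))} {F₀} {R} {P} (s≤s (s≤s z≤n)) (s≤s (s≤s z≤n)) hF₀ hR hP =
  ℕ.+-cancelʳ-≤ 2 _ _ (begin
    7 * (n + t) + 2                             ≤⟨ ℕ.m≤m+n _ (6 + b + q + 2 * q * b) ⟩
    7 * (n + t) + 2 + (6 + b + q + 2 * q * b)  ≡⟨ expand b q ⟩
    2 * (n + n + t * suc n + t) + 12           ≤⟨ ℕ.+-monoˡ-≤ 12 (ℕ.*-monoʳ-≤ 2 (ℕ.+-mono-≤ (ℕ.+-mono-≤ hF₀ hR) hP)) ⟩
    2 * (suc F₀ + R + P) + 12                  ≡⟨ pull-out (F₀ + R + P) ⟩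
    2 * (F₀ + R + P) + 12 + 2                  ∎)
  where
  open ℕ.≤-Reasoning
  expand : ∀ b q → 7 * ((2 + b) + (2 + q)) + 2 + (6 + b + q + 2 * q * b)
                 ≡ 2 * ((2 + b) + (2 + b) + (2 + q) * (3 + b) + (2 + q)) + 12
  expand = ℕ-Solver.solve-∀
  pull-out : ∀ x → 2 * suc x + 12 ≡ 2 * x + 12 + 2
  pull-out = ℕ-Solver.solve-∀

part-b-arithmetic : ∀ {p n t′ P₁ P₂} → 1 ≤ p → 2 ≤ n → 1 ≤ t′ →
                    (2 + t′) * p + (p + (t′ + n)) ≤ (2 + t′) + P₁ → t′ * suc n + (n + n) ≤ suc P₂ →
                    7 * (p + (t′ + n)) ≤ 2 * (P₁ + P₂) + 12
part-b-arithmetic {p@(suc a)} {n@(suc (suc b))} {t′@(suc q)} {P₁} {P₂} (s≤s z≤n) (s≤s (s≤s z≤n)) (s≤s z≤n) hP₁ hP₂ =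
  ℕ.+-cancelʳ-≤ c _ _ (begin
    7 * k + c                                            ≤⟨ ℕ.m≤m+n _ (4 + a + b + q + 2 * q * a + 2 * q * b) ⟩
    7 * k + c + (4 + a + b + q + 2 * q * a + 2 * q * b)  ≡⟨ expand a b q ⟩
    2 * ((2 + t′) * p + k + (t′ * suc n + (n + n))) + 12 ≤⟨ ℕ.+-monoˡ-≤ 12 (ℕ.*-monoʳ-≤ 2 (ℕ.+-mono-≤ hP₁ hP₂)) ⟩
    2 * ((2 + t′) + P₁ + suc P₂) + 12                    ≡⟨ pull-out t′ P₁ P₂ ⟩
    2 * (P₁ + P₂) + 12 + c                               ∎)
  where
  open ℕ.≤-Reasoning
  k = p + (t′ + n)
  c = 2 * (2 + t′) + 2
  expand : ∀ a b q → 7 * ((1 + a) + ((1 + q) + (2 + b))) + (2 * (3 + q) + 2) + (4 + a + b + q + 2 * q * a + 2 * q * b)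
                   ≡ 2 * ((3 + q) * (1 + a) + ((1 + a) + ((1 + q) + (2 + b))) + ((1 + q) * (3 + b) + ((2 + b) + (2 + b)))) + 12
  expand = ℕ-Solver.solve-∀
  pull-out : ∀ t′ P₁ P₂ → 2 * ((2 + t′) + P₁ + suc P₂) + 12 ≡ 2 * (P₁ + P₂) + 12 + (2 * (2 + t′) + 2)
  pull-out = ℕ-Solver.solve-∀

·∈sq : ∀ {S s u} → s ∈ S → u ∈ S → s · u ∈ sq S
·∈sq s∈S u∈S = ∈-concat⁺′ (∈-map⁺ _ u∈S) (∈-map⁺ _ s∈S)

-- The decomposition has t = t′ + 1 ≥ 1 steps, so that sums over Fin t can be split at their last index.
module Decomposition (t′ : ℕ) (m : Fin (2 + t′) → ℕ) (A : Fin (2 + t′) → List ℤ)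
  (m-increasing : ∀ i j → i <F j → m i < m j) (A-unique : ∀ i → Unique (A i)) (A-nonempty : ∀ i → 1 ≤ length (A i))
  where

  t : ℕ
  t = suc t′

  S : List Elt
  S = SList t m A

  levelCard : ℕ → ℕ
  levelCard ℓ = card (atLevel ℓ (sq S))

  ∈S : ∀ i {x} → x ∈ A i → (m i , x) ∈ S
  ∈S i x∈Aᵢ = ∈-concat⁺′ (∈-map⁺ (m i ,_) x∈Aᵢ) (∈-map⁺ (λ i → map (m i ,_) (A i)) (∈-allFin i))

  dilatedSum⊆S² : ∀ i j {w} → InDilatedSum (3 ^ m j) (A i) (A j) w → (m i + m j , w) ∈ sq S
  dilatedSum⊆S² i j (x , y , x∈Aᵢ , y∈Aⱼ , refl) = ·∈sq (∈S i x∈Aᵢ) (∈S j y∈Aⱼ)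

  dilatedSum⊆S²-swap : ∀ i j {w} → InDilatedSum (3 ^ m i) (A j) (A i) w → (m i + m j , w) ∈ sq S
  dilatedSum⊆S²-swap i j {w} w∈ = subst (λ ℓ → (ℓ , w) ∈ sq S) (ℕ.+-comm (m j) (m i)) (dilatedSum⊆S² j i w∈)

  levelCard-sumset : ∀ i j → length (A i) + length (A j) ≤ suc (levelCard (m i + m j))
  levelCard-sumset i j
    with W , !W , W⊆ , bound ← dilatedSum-witness (3 ^ m j) (ℕ.m^n>0 3 (m j)) (A-unique i) (A-unique j)
                                 (A-nonempty i) (A-nonempty j)
    = ℕ.≤-trans bound (s≤s (length≤card-atLevel _ (sq S) !W (dilatedSum⊆S² i j ∘ All.lookup W⊆)))

  levelCard-singleton : ∀ i j → 0 < m i → length (A i) ≡ 1 → 2 ≤ length (A j) →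
                        suc (length (A j)) ≤ levelCard (m i + m j)
  levelCard-singleton i j 0<mᵢ |Aᵢ|≡1 2≤|Aⱼ|
    with W , !W , W⊆ , bound ← translate-dilate-witness (3 ^ m j) (ℕ.^-monoʳ-< 3 (s≤s (s≤s z≤n)) 0<mᵢ)
                                 |Aᵢ|≡1 (A-unique j) 2≤|Aⱼ|
    = ℕ.≤-trans bound (length≤card-atLevel _ (sq S) !W
        ([ dilatedSum⊆S² i j , dilatedSum⊆S²-swap i j ]′ ∘ All.lookup W⊆))

  m-≤-last : ∀ j → m j ≤ m (fromℕ t)
  m-≤-last j with j Fin.≟ fromℕ t
  ... | yes refl = ℕ.≤-refl
  ... | no j≢last = ℕ.<⇒≤ (m-increasing j (fromℕ t) (Fin.≤∧≢⇒< (Fin.≤fromℕ j) j≢last))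

  row column : ℕ
  row    = ∑[ j < suc t ] levelCard (m zero + m j)
  column = ∑[ i < t ] levelCard (m (suc i) + m (fromℕ t))

  row+column≤card : row + column ≤ card (sq S)
  row+column≤card = subst (_≤ card (sq S)) sum≡ (sum-card-atLevel≤card (sq S) (AllPairs.map ℕ.<⇒≢ increasing))
    where
    rowLevels = tabulate (λ j → m zero + m j)
    columnLevels = tabulate (λ i → m (suc i) + m (fromℕ t))
    increasing : AllPairs _<_ (rowLevels ++ columnLevels)
    increasing = AllPairs.++⁺
      (AllPairs.tabulate⁺-< λ j<j′ → ℕ.+-monoʳ-< (m zero) (m-increasing _ _ j<j′))
      (AllPairs.tabulate⁺-< λ i<i′ → ℕ.+-monoˡ-< (m (fromℕ t)) (m-increasing _ _ (s≤s i<i′)))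
      (All.tabulate⁺ λ j → All.tabulate⁺ λ i →
        ℕ.+-mono-<-≤ (m-increasing zero (suc i) (s≤s z≤n)) (m-≤-last j))
    sum≡ : sum (map levelCard (rowLevels ++ columnLevels)) ≡ row + column
    sum≡ = begin
      sum (map levelCard (rowLevels ++ columnLevels))
        ≡⟨ cong sum (List.map-++ levelCard rowLevels columnLevels) ⟩
      sum (map levelCard rowLevels ++ map levelCard columnLevels)
        ≡⟨ sum-++ (map levelCard rowLevels) _ ⟩
      sum (map levelCard rowLevels) + sum (map levelCard columnLevels)
        ≡⟨ cong₂ _+_ (sum-map-tabulate levelCard (λ j → m zero + m j))
                     (sum-map-tabulate levelCard (λ i → m (suc i) + m (fromℕ t))) ⟩
      row + column ∎
      where open ≡-Reasoning

  length-S : length S ≡ ∑[ i < suc t ] length (A i)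
  length-S = begin
    length (concat (map part (allFin (suc t))))       ≡⟨ length-concat (map part (allFin (suc t))) ⟩
    sum (map length (map part (allFin (suc t))))      ≡⟨ cong sum (List.map-∘ {g = length} {f = part} (allFin (suc t))) ⟨
    sum (map (length ∘ part) (allFin (suc t)))        ≡⟨ sum-map-tabulate (length ∘ part) (λ i → i) ⟩
    ∑[ i < suc t ] length (part i)                    ≡⟨ sum-cong-≗ (λ i → List.length-map (m i ,_) (A i)) ⟩
    ∑[ i < suc t ] length (A i)                      ∎
    where
    open ≡-Reasoning
    part : Fin (suc t) → List Elt
    part i = map (m i ,_) (A i)

  m-suc-positive : ∀ i → 0 < m (suc i)
  m-suc-positive i = ℕ.≤-<-trans z≤n (m-increasing zero (suc i) (s≤s z≤n))

  levelCard-positive : ∀ i j → 1 ≤ levelCard (m i + m j)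
  levelCard-positive i j = ℕ.s≤s⁻¹ (ℕ.≤-trans (ℕ.+-mono-≤ (A-nonempty i) (A-nonempty j)) (levelCard-sumset i j))

  part-a : 1 ≤ t′ → 2 ≤ length (A zero) → (∀ i → i ≢ zero → length (A i) ≡ 1) →
           7 * length S ≤ 2 * card (sq S) + 12
  part-a 1≤t′ 2≤n singletons = begin
    7 * length S          ≡⟨ cong (7 *_) (trans length-S (cong (_+_ n) ∑|A∘suc|≡t)) ⟩
    7 * (n + t)           ≤⟨ part-a-arithmetic 2≤n (s≤s 1≤t′) (levelCard-sumset zero zero) row-bound column-bound ⟩
    2 * (row + column) + 12  ≤⟨ ℕ.+-monoˡ-≤ 12 (ℕ.*-monoʳ-≤ 2 row+column≤card) ⟩
    2 * card (sq S) + 12  ∎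
    where
    open ℕ.≤-Reasoning
    n = length (A zero)
    ∑|A∘suc|≡t : ∑[ i < t ] length (A (suc i)) ≡ t
    ∑|A∘suc|≡t = trans (sum-cong-≗ λ i → singletons (suc i) λ ()) (∑-ones t)
    row-bound : t * suc n ≤ ∑[ j < t ] levelCard (m zero + m (suc j))
    row-bound = ∑-≥-const λ j → subst (λ ℓ → suc n ≤ levelCard ℓ) (ℕ.+-comm (m (suc j)) (m zero))
      (levelCard-singleton (suc j) zero (m-suc-positive j) (singletons (suc j) λ ()) 2≤n)
    column-bound : t ≤ ∑[ i < t ] levelCard (m (suc i) + m (fromℕ t))
    column-bound = subst (_≤ ∑[ i < t ] levelCard (m (suc i) + m (fromℕ t))) (ℕ.*-identityʳ t)
      (∑-≥-const λ i → levelCard-positive (suc i) (fromℕ t))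

  row-sumset : suc t * length (A zero) + ∑[ j < suc t ] length (A j) ≤ suc t + row
  row-sumset = begin
    suc t * p + ∑|A|                                ≡⟨ cong (_+ ∑|A|) (∑-const (suc t) p) ⟨
    ∑[ j < suc t ] p + ∑|A|                         ≡⟨ ∑-distrib-+ (λ _ → p) (λ j → length (A j)) ⟨
    ∑[ j < suc t ] (p + length (A j))               ≤⟨ ∑-mono-≤ (levelCard-sumset zero) ⟩
    ∑[ j < suc t ] (1 + levelCard (m zero + m j))   ≡⟨ ∑-distrib-+ (λ _ → 1) (λ j → levelCard (m zero + m j)) ⟩
    ∑[ j < suc t ] 1 + row                          ≡⟨ cong (_+ row) (∑-ones (suc t)) ⟩
    suc t + row                                     ∎
    where
    open ℕ.≤-Reasoning
    p = length (A zero)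
    ∑|A| = ∑[ j < suc t ] length (A j)

  column-large-top : let n = length (A (fromℕ t)) in 2 ≤ n → (∀ i → length (A (suc (inject₁ i))) ≡ 1) →
                     t′ * suc n + (n + n) ≤ suc column
  column-large-top 2≤n middle-singleton = begin
    t′ * suc n + (n + n)                            ≤⟨ ℕ.+-mono-≤ middle (levelCard-sumset (fromℕ t) (fromℕ t)) ⟩
    ∑[ i < t′ ] level (inject₁ i) + suc (level (fromℕ t′))  ≡⟨ ℕ.+-suc _ _ ⟩
    suc (∑[ i < t′ ] level (inject₁ i) + level (fromℕ t′))  ≡⟨ cong suc (sum-init-last level) ⟨
    suc (∑[ i < t ] level i)                                ∎
    where
    open ℕ.≤-Reasoning
    n = length (A (fromℕ t))
    level : Fin t → ℕ
    level i = levelCard (m (suc i) + m (fromℕ t))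
    middle : t′ * suc n ≤ ∑[ i < t′ ] level (inject₁ i)
    middle = ∑-≥-const λ i →
      levelCard-singleton (suc (inject₁ i)) (fromℕ t) (m-suc-positive (inject₁ i)) (middle-singleton i) 2≤n

  part-b : 1 ≤ t′ → 2 ≤ length (A (fromℕ t)) → (∀ i → i ≢ zero → i ≢ fromℕ t → length (A i) ≡ 1) →
           7 * length S ≤ 2 * card (sq S) + 12
  part-b 1≤t′ 2≤n singletons = begin
    7 * length S          ≡⟨ cong (7 *_) (trans length-S ∑|A|≡p+t′+n) ⟩
    7 * (p + (t′ + n))    ≤⟨ part-b-arithmetic (A-nonempty zero) 2≤n 1≤t′
                               (subst (λ k → suc t * p + k ≤ suc t + row) ∑|A|≡p+t′+n row-sumset)
                               (column-large-top 2≤n middle-singleton) ⟩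
    2 * (row + column) + 12  ≤⟨ ℕ.+-monoˡ-≤ 12 (ℕ.*-monoʳ-≤ 2 row+column≤card) ⟩
    2 * card (sq S) + 12  ∎
    where
    open ℕ.≤-Reasoning
    p = length (A zero)
    n = length (A (fromℕ t))
    middle-singleton : ∀ i → length (A (suc (inject₁ i))) ≡ 1
    middle-singleton i = singletons _ (λ ()) (Fin.fromℕ≢inject₁ ∘ sym ∘ Fin.suc-injective)
    ∑|A|≡p+t′+n : ∑[ i < suc t ] length (A i) ≡ p + (t′ + n)
    ∑|A|≡p+t′+n = cong (_+_ p) (begin-equality
      ∑[ i < t ] length (A (suc i))                 ≡⟨ sum-init-last (λ i → length (A (suc i))) ⟩
      ∑[ i < t′ ] length (A (suc (inject₁ i))) + n  ≡⟨ cong (_+ n) (trans (sum-cong-≗ middle-singleton) (∑-ones t′)) ⟩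
      t′ + n                                        ∎)

lemma2p2 : (t : ℕ) → 2 ≤ t →
           (m : Fin (suc t) → ℕ) → (∀ i j → i <F j → m i < m j) →
           (A : Fin (suc t) → List ℤ) → (∀ i → Unique (A i)) → (∀ i → 1 ≤ length (A i)) →
           ((2 ≤ length (A zero) → (∀ i → i ≢ zero → length (A i) ≡ 1) →
               7 * length (SList t m A) ≤ 2 * card (sq (SList t m A)) + 12)
           × (2 ≤ length (A (fromℕ t)) → (∀ i → i ≢ zero → i ≢ fromℕ t → length (A i) ≡ 1) →
               7 * length (SList t m A) ≤ 2 * card (sq (SList t m A)) + 12))
lemma2p2 _ (s≤s (s≤s (z≤n {u}))) m m-increasing A A-unique A-nonempty = part-a (s≤s z≤n) , part-b (s≤s z≤n)
  where open Decomposition (suc u) m A m-increasing A-unique A-nonempty
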